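{- Let $I$ be a finite Farey interval which contains a $4$-aloof number. Then $\frac15\le \frac{|L(I)|}{|R(I)|}\le 5$, where $|J|$ denotes the length of an interval $J$.
   Context: A Farey interval is an open interval $(\frac{p_1}{q_1},\frac{p_2}{q_2})\subset(0,\infty)$ whose endpoints are given by nonnegative integers $p_1,q_1,p_2,q_2$ with $p_2q_1-p_1q_2=1$, where $\frac01=0$ and $\frac10=\infty$ are allowed. For a Farey interval $J=(\frac{p_1}{q_1},\frac{p_2}{q_2})$ define its two Farey subintervals $L(J)=(\frac{p_1}{q_1},\frac{p_1+p_2}{q_1+q_2})$ and $R(J)=(\frac{p_1+p_2}{q_1+q_2},\frac{p_2}{q_2})$. A Farey interval is finite if $q_2>0$. A real number $x>0$ is $n$-aloof if $x$ is irrational and all terms of its continued fraction expansion $x=[a_0;a_1,a_2,\ldots]$ (with $a_0\ge0$, $a_i\ge1$ for $i\ge1$ integers) satisfy $a_i\le n$ for all $i\ge0$. -}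

module Defs where

open import Data.Nat using (ℕ; zero; suc; _+_; _*_; _≤_; _<_)
open import Data.Integer using (+_)
open import Data.Product using (_×_; _,_; proj₁; proj₂; ∃-syntax)
open import Relation.Binary.PropositionalEquality using (_≡_)
import Data.Rational as ℚ
open ℚ using (ℚ)

-- Extended nonnegative fractions p/q given by a pair of naturals
-- (1/0 = ∞ allowed, 0/1 = 0).

Frac : Set
Frac = ℕ × ℕ

num den : Frac → ℕ
num = proj₁
den = proj₂

record Interval : Set where
  constructor ⟨_,_⟩
  field
    left right : Frac
open Interval public

-- Farey interval: p₂ q₁ − p₁ q₂ = 1  (stated in ℕ as p₂ q₁ = p₁ q₂ + 1).
IsFarey : Interval → Set
IsFarey ⟨ (p₁ , q₁) , (p₂ , q₂) ⟩ = p₂ * q₁ ≡ p₁ * q₂ + 1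

IsFinite : Interval → Set
IsFinite ⟨ _ , (_ , q₂) ⟩ = 0 < q₂

mediant : Frac → Frac → Frac
mediant (p₁ , q₁) (p₂ , q₂) = (p₁ + p₂ , q₁ + q₂)

L R : Interval → Interval
L ⟨ a , b ⟩ = ⟨ a , mediant a b ⟩
R ⟨ a , b ⟩ = ⟨ mediant a b , b ⟩

-- The denominator 0
-- (the value ∞) is sent to the junk value 0; this case never arises for
-- endpoints of the intervals L(I), R(I) with I a finite Farey interval.

toℚ : Frac → ℚ
toℚ (p , zero)  = ℚ.0ℚ
toℚ (p , suc q) = (+ p) ℚ./ suc q

length : Interval → ℚ
length ⟨ a , b ⟩ = toℚ b ℚ.- toℚ a

-- Real numbers x > 0 that are irrational are represented by their
-- (infinite, unique) continued fraction expansion [a₀; a₁, a₂, …].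

record CF : Set where
  field
    a   : ℕ → ℕ
    pos : ∀ i → 1 ≤ a (suc i)
open CF public

IsAloof : ℕ → CF → Set
IsAloof n x = ∀ i → a x i ≤ n

-- Convergents h_i / k_i, via the standard recurrences
--   h_i = a_i h_{i-1} + h_{i-2},  k_i = a_i k_{i-1} + k_{i-2},
--   (h_{-1},k_{-1}) = (1,0), (h_{-2},k_{-2}) = (0,1).
-- convPair x i = ((h_{i-1},k_{i-1}) , (h_{i-2},k_{i-2}))  shifted so that
-- convergent x i = (h_i , k_i).
convPair : CF → ℕ → Frac × Frac
convPair x zero    = ((1 , 0) , (0 , 1))
convPair x (suc i) with convPair x i
... | ((h₁ , k₁) , (h₂ , k₂)) = ((a x i * h₁ + h₂ , a x i * k₁ + k₂) , (h₁ , k₁))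

convergent : CF → ℕ → Frac
convergent x i = proj₁ (convPair x (suc i))

-- Strict order between fractions by cross multiplication
-- (valid for nonnegative fractions with positive denominators).
_<ᶠ_ : Frac → Frac → Set
(p , q) <ᶠ (p′ , q′) = p * q′ < p′ * q

-- Since x is irrational, x lies strictly between any two
-- consecutive convergents, and the convergents tend to x; hence
--   r < x  iff  some two consecutive convergents both exceed r,
--   x < r  iff  some two consecutive convergents are both below r.
-- (For r = 1/0 = ∞ the second clause holds automatically, as it should.)
_<ˣ_ : Frac → CF → Set
r <ˣ x = ∃[ i ] (r <ᶠ convergent x i × r <ᶠ convergent x (suc i))

_ˣ<_ : CF → Frac → Set
x ˣ< r = ∃[ i ] (convergent x i <ᶠ r × convergent x (suc i) <ᶠ r)

_∈ᴵ_ : CF → Interval → Set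
x ∈ᴵ J = left J <ˣ x × x ˣ< right J

{-# OPTIONS --safe #-}
-- Write x = a₀ + 1/x′. If x lies in a finite Farey interval I = (p₁/q₁, p₂/q₂), then
-- a₀ q₂ < p₂, and a₀ q₁ ≤ p₁ because no integer lies strictly inside a Farey interval.
-- Hence y ↦ 1/(y − a₀) maps I onto the Farey interval J = (q₂/d₂, q₁/d₁) ∋ x′, where
-- dᵢ = pᵢ − a₀ qᵢ: the denominators of I are the numerators of J, and the numerators
-- of I are a₀ times the numerators of J plus the denominators of J. Following this
-- Gauss map, one shows by induction that for an n-aloof x the two numerators (when
-- p₁ > 0) and the two denominators (when q₂ > 0) of I are within a factor n + 1 of
-- each other. The base case is an interval (p/1, ∞) ∋ x, where p ≤ a₀ ≤ n. Finally,
-- |L(I)| = 1/(q₁(q₁+q₂)) and |R(I)| = 1/(q₂(q₁+q₂)), so |L(I)|/|R(I)| = q₂/q₁.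
module Submission where

open import Defs

module Tameness where
  open import Data.Empty using (⊥; ⊥-elim)
  open import Data.Nat
  open import Data.Nat.Induction using (<-wellFounded)
  open import Data.Nat.Properties
  open import Data.Nat.Tactic.RingSolver using (solve-∀)
  open import Algebra.Properties.CommutativeSemigroup *-commutativeSemigroup using (xy∙z≈xz∙y; x∙yz≈y∙xz)
  open import Data.Product using (_×_; _,_; proj₁; proj₂; ∃-syntax; map)
  open import Function using (_∘_)
  open import Induction.WellFounded using (Acc; acc)
  open import Relation.Binary.PropositionalEquality
  open import Relation.Nullary using (yes; no)

  shift : CF → CF
  shift x = record { a = a x ∘ suc ; pos = pos x ∘ suc }

  -- prependᶠ c r is the fraction c + 1/r, and prepend c J is the image of J under
  -- y ↦ c + 1/y, which reverses the order of the endpoints.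
  prependᶠ : ℕ → Frac → Frac
  prependᶠ c (h , k) = (c * h + k , h)

  prepend : ℕ → Interval → Interval
  prepend c ⟨ r , s ⟩ = ⟨ prependᶠ c s , prependᶠ c r ⟩

  -- By definition of convPair,
  -- convergent x (2 + i) = combine (a x (2 + i)) (convergent x (1 + i)) (convergent x i).
  combine : ℕ → Frac → Frac → Frac
  combine c (h₁ , k₁) (h₀ , k₀) = (c * h₁ + h₀ , c * k₁ + k₀)

  combine-prependᶠ : ∀ c d r s →
    combine c (prependᶠ d r) (prependᶠ d s) ≡ prependᶠ d (combine c r s)
  combine-prependᶠ c d (h₁ , k₁) (h₀ , k₀) = cong (_, c * h₁ + h₀) (linear c d h₁ k₁ h₀ k₀)
    where
    linear : ∀ c d h₁ k₁ h₀ k₀ →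
      c * (d * h₁ + k₁) + (d * h₀ + k₀) ≡ d * (c * h₁ + h₀) + (c * k₁ + k₀)
    linear = solve-∀

  convPair-shift : ∀ x n →
    convPair x (suc n) ≡ map (prependᶠ (a x 0)) (prependᶠ (a x 0)) (convPair (shift x) n)
  convPair-shift x zero rewrite *-zeroʳ (a x 0) = refl
  convPair-shift x (suc n) =
    trans (cong (step (a x (suc n))) (convPair-shift x n))
          (cong (_, prependᶠ (a x 0) r) (combine-prependᶠ (a x (suc n)) (a x 0) r s))
    where
    r = proj₁ (convPair (shift x) n)
    s = proj₂ (convPair (shift x) n)
    step : ℕ → Frac × Frac → Frac × Frac
    step c (r , s) = (combine c r s , r)

  convergent-zero : ∀ x → convergent x 0 ≡ (a x 0 , 1)
  convergent-zero x rewrite *-identityʳ (a x 0) | +-identityʳ (a x 0) | *-zeroʳ (a x 0) = refl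

  convergent-suc : ∀ x j → convergent x (suc j) ≡ prependᶠ (a x 0) (convergent (shift x) j)
  convergent-suc x j = cong proj₁ (convPair-shift x (suc j))

  convergent-cases : ∀ x (P : Frac → Set) → P (a x 0 , 1) →
    (∀ j → P (prependᶠ (a x 0) (convergent (shift x) j))) → ∀ j → P (convergent x j)
  convergent-cases x P P₀ Pₛ zero    = subst P (sym (convergent-zero x)) P₀
  convergent-cases x P P₀ Pₛ (suc j) = subst P (sym (convergent-suc x j)) (Pₛ j)

  a₀*den≤num : ∀ x j → a x 0 * den (convergent x j) ≤ num (convergent x j)
  a₀*den≤num x = convergent-cases x (λ r → a x 0 * den r ≤ num r)
    (≤-reflexive (*-identityʳ (a x 0))) (λ _ → m≤m+n _ _)

  den≤num : ∀ x j → 1 ≤ a x 0 → den (convergent x j) ≤ num (convergent x j)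
  den≤num x j 1≤a₀ = ≤-trans (m≤n*m _ (a x 0) {{>-nonZero 1≤a₀}}) (a₀*den≤num x j)

  num≤[1+a₀]*den : ∀ x j → num (convergent x j) ≤ suc (a x 0) * den (convergent x j)
  num≤[1+a₀]*den x = convergent-cases x (λ r → num r ≤ suc (a x 0) * den r)
    (≤-trans (n≤1+n _) (m≤m*n (suc (a x 0)) 1)) step
    where
    step : ∀ j → let (h , k) = convergent (shift x) j in a x 0 * h + k ≤ suc (a x 0) * h
    step j = begin
      a x 0 * h + k ≤⟨ +-monoʳ-≤ (a x 0 * h) (den≤num (shift x) j (pos x 0)) ⟩
      a x 0 * h + h ≡⟨ +-comm (a x 0 * h) h ⟩
      suc (a x 0) * h ∎
      where
      open ≤-Reasoning
      h = num (convergent (shift x) j)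
      k = den (convergent (shift x) j)

  ˣ<⇒a₀*q<p : ∀ {x p q} → x ˣ< (p , q) → a x 0 * q < p
  ˣ<⇒a₀*q<p {x} {p} {q} (j , hq<pk , _) = *-cancelʳ-< k (a x 0 * q) p (begin-strict
    a x 0 * q * k ≡⟨ xy∙z≈xz∙y (a x 0) q k ⟩
    a x 0 * k * q ≤⟨ *-monoˡ-≤ q (a₀*den≤num x j) ⟩
    h * q         <⟨ hq<pk ⟩
    p * k         ∎)
    where
    open ≤-Reasoning
    h = num (convergent x j)
    k = den (convergent x j)

  <ˣ⇒p<[1+a₀]*q : ∀ {x p q} → (p , q) <ˣ x → p < suc (a x 0) * q
  <ˣ⇒p<[1+a₀]*q {x} {p} {q} (j , pk<hq , _) = *-cancelʳ-< k p (suc (a x 0) * q) (begin-strict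
    p * k               <⟨ pk<hq ⟩
    h * q               ≤⟨ *-monoˡ-≤ q (num≤[1+a₀]*den x j) ⟩
    suc (a x 0) * k * q ≡⟨ xy∙z≈xz∙y (suc (a x 0)) k q ⟩
    suc (a x 0) * q * k ∎)
    where
    open ≤-Reasoning
    h = num (convergent x j)
    k = den (convergent x j)

  combine-<ᶠ : ∀ c r s t → r <ᶠ t → s <ᶠ t → combine c s r <ᶠ t
  combine-<ᶠ c (h₀ , k₀) (h₁ , k₁) (p , q) r<t s<t = begin-strict
    (c * h₁ + h₀) * q       ≡⟨ *-distribʳ-+ q (c * h₁) h₀ ⟩
    c * h₁ * q + h₀ * q     ≡⟨ cong (_+ h₀ * q) (*-assoc c h₁ q) ⟩
    c * (h₁ * q) + h₀ * q   <⟨ +-mono-≤-< (*-monoʳ-≤ c (<⇒≤ s<t)) r<t ⟩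
    c * (p * k₁) + p * k₀   ≡⟨ cong (_+ p * k₀) (x∙yz≈y∙xz p c k₁) ⟨
    p * (c * k₁) + p * k₀   ≡⟨ *-distribˡ-+ p (c * k₁) k₀ ⟨
    p * (c * k₁ + k₀)       ∎
    where open ≤-Reasoning

  <ᶠ-combine : ∀ c r s t → t <ᶠ r → t <ᶠ s → t <ᶠ combine c s r
  <ᶠ-combine c (h₀ , k₀) (h₁ , k₁) (p , q) t<r t<s = begin-strict
    p * (c * k₁ + k₀)       ≡⟨ *-distribˡ-+ p (c * k₁) k₀ ⟩
    p * (c * k₁) + p * k₀   ≡⟨ cong (_+ p * k₀) (x∙yz≈y∙xz p c k₁) ⟩
    c * (p * k₁) + p * k₀   <⟨ +-mono-≤-< (*-monoʳ-≤ c (<⇒≤ t<s)) t<r ⟩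
    c * (h₁ * q) + h₀ * q   ≡⟨ cong (_+ h₀ * q) (*-assoc c h₁ q) ⟨
    c * h₁ * q + h₀ * q     ≡⟨ *-distribʳ-+ q (c * h₁) h₀ ⟨
    (c * h₁ + h₀) * q       ∎
    where open ≤-Reasoning

  prependᶠ-cancel-<ᶠ : ∀ c r s → prependᶠ c r <ᶠ prependᶠ c s → s <ᶠ r
  prependᶠ-cancel-<ᶠ c (h , k) (u , v) lt = +-cancelˡ-< (c * h * u) (u * k) (h * v) (begin-strict
    c * h * u + u * k   ≡⟨ expandˡ c h k u ⟩
    (c * h + k) * u     <⟨ lt ⟩
    (c * u + v) * h     ≡⟨ expandʳ c h u v ⟩
    c * h * u + h * v   ∎)
    where
    open ≤-Reasoning
    expandˡ : ∀ c h k u → c * h * u + u * k ≡ (c * h + k) * u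
    expandˡ = solve-∀
    expandʳ : ∀ c h u v → (c * u + v) * h ≡ c * h * u + h * v
    expandʳ = solve-∀

  ˣ<-prependᶠ⁻ : ∀ {x r} → x ˣ< prependᶠ (a x 0) r → r <ˣ shift x
  ˣ<-prependᶠ⁻ {x} {r} (i , cᵢ<P , cᵢ₊₁<P) =
    i , below i cᵢ₊₁<P , below (suc i) cᵢ₊₂<P
    where
    cᵢ₊₂<P = combine-<ᶠ (a x (2 + i)) _ _ (prependᶠ (a x 0) r) cᵢ<P cᵢ₊₁<P
    below : ∀ j → convergent x (suc j) <ᶠ prependᶠ (a x 0) r → r <ᶠ convergent (shift x) j
    below j = prependᶠ-cancel-<ᶠ (a x 0) _ r
            ∘ subst (_<ᶠ prependᶠ (a x 0) r) (convergent-suc x j)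

  <ˣ-prependᶠ⁻ : ∀ {x r} → prependᶠ (a x 0) r <ˣ x → shift x ˣ< r
  <ˣ-prependᶠ⁻ {x} {r} (i , P<cᵢ , P<cᵢ₊₁) =
    i , above i P<cᵢ₊₁ , above (suc i) P<cᵢ₊₂
    where
    P<cᵢ₊₂ = <ᶠ-combine (a x (2 + i)) _ _ (prependᶠ (a x 0) r) P<cᵢ P<cᵢ₊₁
    above : ∀ j → prependᶠ (a x 0) r <ᶠ convergent x (suc j) → convergent (shift x) j <ᶠ r
    above j = prependᶠ-cancel-<ᶠ (a x 0) r _
            ∘ subst (prependᶠ (a x 0) r <ᶠ_) (convergent-suc x j)

  shift-∈ᴵ : ∀ x J → x ∈ᴵ prepend (a x 0) J → shift x ∈ᴵ J
  shift-∈ᴵ x ⟨ r , s ⟩ (l , u) = ˣ<-prependᶠ⁻ {x} {r} u , <ˣ-prependᶠ⁻ {x} {s} l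

  isFarey⇒0<p₂ : ∀ J → IsFarey J → 0 < num (right J)
  isFarey⇒0<p₂ ⟨ (p₁ , q₁) , (zero  , q₂) ⟩ F = ⊥-elim (m+1+n≢0 (p₁ * q₂) (sym F))
  isFarey⇒0<p₂ ⟨ (p₁ , q₁) , (suc _ , q₂) ⟩ F = z<s

  isFarey⇒0<q₁ : ∀ J → IsFarey J → 0 < den (left J)
  isFarey⇒0<q₁ ⟨ (p₁ , zero)  , (p₂ , q₂) ⟩ F =
    ⊥-elim (m+1+n≢0 (p₁ * q₂) (trans (sym F) (*-zeroʳ p₂)))
  isFarey⇒0<q₁ ⟨ (p₁ , suc _) , (p₂ , q₂) ⟩ F = z<s

  isFarey⇒no-integer-inside : ∀ c p₁ q₁ p₂ q₂ → IsFarey ⟨ (p₁ , q₁) , (p₂ , q₂) ⟩ →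
    0 < q₂ → p₁ < c * q₁ → c * q₂ < p₂ → ⊥
  isFarey⇒no-integer-inside c p₁ q₁ p₂ q₂ F 0<q₂ p₁<cq₁ cq₂<p₂ =
    1+n≰n (+-cancelˡ-≤ (p₁ * q₂) 2 1 (begin
      p₁ * q₂ + 2          ≤⟨ +-monoʳ-≤ (p₁ * q₂) (+-mono-≤ 0<q₂ 0<q₁) ⟩
      p₁ * q₂ + (q₂ + q₁)  ≡⟨ +-assoc (p₁ * q₂) q₂ q₁ ⟨
      p₁ * q₂ + q₂ + q₁    ≡⟨ cong (_+ q₁) (+-comm (p₁ * q₂) q₂) ⟩
      suc p₁ * q₂ + q₁     ≤⟨ +-monoˡ-≤ q₁ (*-monoˡ-≤ q₂ p₁<cq₁) ⟩
      c * q₁ * q₂ + q₁     ≡⟨ +-comm (c * q₁ * q₂) q₁ ⟩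
      q₁ + c * q₁ * q₂     ≡⟨ cong (q₁ +_) (xy∙z≈xz∙y c q₁ q₂) ⟩
      suc (c * q₂) * q₁    ≤⟨ *-monoˡ-≤ q₁ cq₂<p₂ ⟩
      p₂ * q₁              ≡⟨ F ⟩
      p₁ * q₂ + 1          ∎))
    where
    open ≤-Reasoning
    0<q₁ = isFarey⇒0<q₁ ⟨ (p₁ , q₁) , (p₂ , q₂) ⟩ F

  ∃-prepend-a₀ : ∀ x I → IsFarey I → 0 < den (right I) → x ˣ< right I →
    ∃[ J ] I ≡ prepend (a x 0) J
  ∃-prepend-a₀ x ⟨ (p₁ , q₁) , (p₂ , q₂) ⟩ F 0<q₂ x<r with a x 0 * q₁ ≤? p₁
  ... | no a₀q₁≰p₁ =
    ⊥-elim (isFarey⇒no-integer-inside (a x 0) p₁ q₁ p₂ q₂ F 0<q₂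
                                       (≰⇒> a₀q₁≰p₁) (ˣ<⇒a₀*q<p x<r))
  ... | yes a₀q₁≤p₁
    with d₁ , refl ← m≤n⇒∃[o]m+o≡n a₀q₁≤p₁
       | d₂ , refl ← m≤n⇒∃[o]m+o≡n (<⇒≤ (ˣ<⇒a₀*q<p {x} {p₂} {q₂} x<r))
    = ⟨ (q₂ , d₂) , (q₁ , d₁) ⟩ , refl

  isFarey-prepend⁻ : ∀ c J → IsFarey (prepend c J) → IsFarey J
  isFarey-prepend⁻ c ⟨ (u₁ , v₁) , (u₂ , v₂) ⟩ F = +-cancelˡ-≡ (c * u₁ * u₂) _ _ (begin
    c * u₁ * u₂ + u₂ * v₁      ≡⟨ expandˡ c u₁ v₁ u₂ ⟩
    (c * u₁ + v₁) * u₂         ≡⟨ F ⟩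
    (c * u₂ + v₂) * u₁ + 1     ≡⟨ expandʳ c u₁ u₂ v₂ ⟩
    c * u₁ * u₂ + (u₁ * v₂ + 1) ∎)
    where
    open ≡-Reasoning
    expandˡ : ∀ c u₁ v₁ u₂ → c * u₁ * u₂ + u₂ * v₁ ≡ (c * u₁ + v₁) * u₂
    expandˡ = solve-∀
    expandʳ : ∀ c u₁ u₂ v₂ → (c * u₂ + v₂) * u₁ + 1 ≡ c * u₁ * u₂ + (u₁ * v₂ + 1)
    expandʳ = solve-∀

  size : Interval → ℕ
  size ⟨ (p₁ , q₁) , (p₂ , q₂) ⟩ = p₁ + q₁ + p₂ + q₂

  size-prepend : ∀ c J → 1 ≤ c → IsFarey J → size J < size (prepend c J)
  size-prepend c J@(⟨ (u₁ , v₁) , (u₂ , v₂) ⟩) 1≤c F = begin-strict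
    size J                  <⟨ m<m+n (size J) (*-mono-≤ 1≤c 0<u₁+u₂) ⟩
    size J + c * (u₁ + u₂)  ≡⟨ expand c u₁ v₁ u₂ v₂ ⟩
    size (prepend c J)      ∎
    where
    open ≤-Reasoning
    0<u₁+u₂ = ≤-trans (isFarey⇒0<p₂ J F) (m≤n+m u₂ u₁)
    expand : ∀ c u₁ v₁ u₂ v₂ →
      u₁ + v₁ + u₂ + v₂ + c * (u₁ + u₂) ≡ c * u₂ + v₂ + u₂ + (c * u₁ + v₁) + u₁
    expand = solve-∀

  record Balanced (k m n : ℕ) : Set where
    constructor balanced
    field
      m≤k*n : m ≤ k * n
      n≤k*m : n ≤ k * m

  balanced-sym : ∀ {k m n} → Balanced k m n → Balanced k n m
  balanced-sym (balanced m≤k*n n≤k*m) = balanced n≤k*m m≤k*n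

  balanced-linear : ∀ {k m₁ n₁ m₂ n₂} c → Balanced k m₁ n₁ → Balanced k m₂ n₂ →
    Balanced k (c * m₁ + m₂) (c * n₁ + n₂)
  balanced-linear {k} c (balanced m₁≤ n₁≤) (balanced m₂≤ n₂≤) =
    balanced (bound _ _ _ _ m₁≤ m₂≤) (bound _ _ _ _ n₁≤ n₂≤)
    where
    bound : ∀ m₁ n₁ m₂ n₂ → m₁ ≤ k * n₁ → m₂ ≤ k * n₂ → c * m₁ + m₂ ≤ k * (c * n₁ + n₂)
    bound m₁ n₁ m₂ n₂ m₁≤ m₂≤ = begin
      c * m₁ + m₂            ≤⟨ +-mono-≤ (*-monoʳ-≤ c m₁≤) m₂≤ ⟩
      c * (k * n₁) + k * n₂  ≡⟨ cong (_+ k * n₂) (x∙yz≈y∙xz c k n₁) ⟩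
      k * (c * n₁) + k * n₂  ≡⟨ *-distribˡ-+ k (c * n₁) n₂ ⟨
      k * (c * n₁ + n₂)      ∎
      where open ≤-Reasoning

  balanced-1 : ∀ {k m} → 0 < m → m ≤ k → Balanced k m 1
  balanced-1 {k} 0<m m≤k =
    balanced (≤-trans m≤k (≤-reflexive (sym (*-identityʳ k)))) (*-mono-≤ (≤-trans 0<m m≤k) 0<m)

  balanced-c-c*u+1 : ∀ {n c u} → 0 < c → c ≤ n → u ≤ n → Balanced (suc n) c (c * u + 1)
  balanced-c-c*u+1 {n} {c} {u} 0<c c≤n u≤n = balanced
    (≤-trans (Balanced.m≤k*n (balanced-1 0<c (m≤n⇒m≤1+n c≤n)))
             (*-monoʳ-≤ (suc n) (m≤n+m 1 (c * u))))
    (begin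
      c * u + 1      ≤⟨ +-mono-≤ (*-monoʳ-≤ c u≤n) 0<c ⟩
      c * n + c      ≡⟨ +-comm (c * n) c ⟩
      c + c * n      ≡⟨ cong (c +_) (*-comm c n) ⟩
      suc n * c      ∎)
    where open ≤-Reasoning

  -- The last field is needed when I = (c, c + 1/u) comes from the unbounded J = (u/1, ∞).
  record Tame (n : ℕ) (I : Interval) : Set where
    constructor mkTame
    field
      numerators   : 0 < num (left I)  → Balanced (suc n) (num (left I)) (num (right I))
      denominators : 0 < den (right I) → Balanced (suc n) (den (left I)) (den (right I))
      unbounded    : den (right I) ≡ 0 → num (left I) ≤ n

  tame-∞ : ∀ {n} x p₁ q₁ p₂ → IsAloof n x → IsFarey ⟨ (p₁ , q₁) , (p₂ , 0) ⟩ →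
    (p₁ , q₁) <ˣ x → Tame n ⟨ (p₁ , q₁) , (p₂ , 0) ⟩
  tame-∞ x p₁ q₁ p₂ aloof F p₁<x
    with refl ← m*n≡1⇒m≡1 p₂ q₁ (trans F (cong (_+ 1) (*-zeroʳ p₁)))
       | refl ← m*n≡1⇒n≡1 p₂ q₁ (trans F (cong (_+ 1) (*-zeroʳ p₁)))
    = mkTame (λ 0<p₁ → balanced-1 0<p₁ (m≤n⇒m≤1+n p₁≤n)) (λ ()) (λ _ → p₁≤n)
    where
    p₁≤a₀ = ≤-pred (subst (p₁ <_) (*-identityʳ (suc (a x 0))) (<ˣ⇒p<[1+a₀]*q p₁<x))
    p₁≤n = ≤-trans p₁≤a₀ (aloof 0)

  tame-prepend : ∀ {n} c J → c ≤ n → 0 < num (left J) → IsFarey J → Tame n J →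
    Tame n (prepend c J)
  tame-prepend c ⟨ (suc u₁ , v₁) , (u₂ , suc v₂) ⟩ c≤n _ _ (mkTame nums dens _) = mkTame
    (λ _ → balanced-linear c (balanced-sym (nums z<s)) (balanced-sym (dens z<s)))
    (λ _ → balanced-sym (nums z<s))
    (λ ())
  tame-prepend {n} c ⟨ (suc u₁ , v₁) , (u₂ , zero) ⟩ c≤n _ F (mkTame nums _ unbounded)
    with refl ← m*n≡1⇒m≡1 u₂ v₁ (trans F (cong (_+ 1) (*-zeroʳ (suc u₁))))
       | refl ← m*n≡1⇒n≡1 u₂ v₁ (trans F (cong (_+ 1) (*-zeroʳ (suc u₁))))
    = mkTame numerators (λ _ → balanced-sym (nums z<s)) (λ ())
    where
    numerators : 0 < c * 1 + 0 → Balanced (suc n) (c * 1 + 0) (c * suc u₁ + 1)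
    numerators rewrite *-identityʳ c | +-identityʳ c =
      λ 0<c → balanced-c-c*u+1 0<c c≤n (unbounded refl)

  tame-step : ∀ {n} x I → IsAloof n x → IsFarey I → x ∈ᴵ I →
    (∀ J → I ≡ prepend (a x 0) J → IsFarey J → shift x ∈ᴵ J → Tame n J) → Tame n I
  tame-step x ⟨ (p₁ , q₁) , (p₂ , zero) ⟩ aloof F (l<x , _) _ = tame-∞ x p₁ q₁ p₂ aloof F l<x
  tame-step x I@(⟨ _ , (_ , suc _) ⟩) aloof F x∈I tame-J
    with J , refl ← ∃-prepend-a₀ x I F z<s (proj₂ x∈I)
    = tame-prepend (a x 0) J (aloof 0) z<s F-J (tame-J J refl F-J (shift-∈ᴵ x J x∈I))
    where
    F-J = isFarey-prepend⁻ (a x 0) J F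

  tame-acc : ∀ {n} x I → Acc _<_ (size I) → 1 ≤ a x 0 → IsAloof n x → IsFarey I → x ∈ᴵ I →
    Tame n I
  tame-acc x I (acc rec) 1≤a₀ aloof F x∈I = tame-step x I aloof F x∈I λ J I≡ F-J x′∈J →
    let size-J<size-I = subst ((size J <_) ∘ size) (sym I≡) (size-prepend (a x 0) J 1≤a₀ F-J)
    in tame-acc (shift x) J (rec size-J<size-I) (pos x 0) (aloof ∘ suc) F-J x′∈J

  -- a x 0 may vanish, but every tail has a₀ ≥ 1, so from the second step on size decreases.
  tame : ∀ {n} x I → IsAloof n x → IsFarey I → x ∈ᴵ I → Tame n I
  tame x I aloof F x∈I = tame-step x I aloof F x∈I λ J _ F-J x′∈J →
    tame-acc (shift x) J (<-wellFounded (size J)) (pos x 0) (aloof ∘ suc) F-J x′∈J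


module Lengths where
  open import Data.Nat using (ℕ; suc; _+_; _*_; _≤_)
  open import Data.Nat.Properties
  open import Algebra.Properties.CommutativeSemigroup +-commutativeSemigroup using (xy∙z≈xz∙y)
  open import Data.Integer as ℤ using (+_)
  import Data.Integer.Properties as ℤ
  open import Data.Product using (_,_)
  open import Data.Rational as ℚ using (toℚᵘ)
  import Data.Rational.Properties as ℚ
  open import Data.Rational.Unnormalised as ℚᵘ using (mkℚᵘ; *≤*)
  import Data.Rational.Unnormalised.Properties as ℚᵘ
  open import Relation.Binary.PropositionalEquality

  isFarey-L : ∀ I → IsFarey I → IsFarey (L I)
  isFarey-L ⟨ (p₁ , q₁) , (p₂ , q₂) ⟩ F = begin
    (p₁ + p₂) * q₁            ≡⟨ *-distribʳ-+ q₁ p₁ p₂ ⟩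
    p₁ * q₁ + p₂ * q₁         ≡⟨ cong (λ z → p₁ * q₁ + z) F ⟩
    p₁ * q₁ + (p₁ * q₂ + 1)   ≡⟨ +-assoc (p₁ * q₁) (p₁ * q₂) 1 ⟨
    p₁ * q₁ + p₁ * q₂ + 1     ≡⟨ cong (_+ 1) (*-distribˡ-+ p₁ q₁ q₂) ⟨
    p₁ * (q₁ + q₂) + 1        ∎
    where open ≡-Reasoning

  isFarey-R : ∀ I → IsFarey I → IsFarey (R I)
  isFarey-R ⟨ (p₁ , q₁) , (p₂ , q₂) ⟩ F = begin
    p₂ * (q₁ + q₂)            ≡⟨ *-distribˡ-+ p₂ q₁ q₂ ⟩
    p₂ * q₁ + p₂ * q₂         ≡⟨ cong (_+ p₂ * q₂) F ⟩
    p₁ * q₂ + 1 + p₂ * q₂     ≡⟨ xy∙z≈xz∙y (p₁ * q₂) 1 (p₂ * q₂) ⟩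
    p₁ * q₂ + p₂ * q₂ + 1     ≡⟨ cong (_+ 1) (*-distribʳ-+ q₂ p₁ p₂) ⟨
    (p₁ + p₂) * q₂ + 1        ∎
    where open ≡-Reasoning

  -- The left-hand side is the numerator of p₂/q₂ − p₁/q₁ in ℚᵘ.
  isFarey⇒det≡1 : ∀ p₁ q₁ p₂ q₂ → IsFarey ⟨ (p₁ , q₁) , (p₂ , q₂) ⟩ →
    + p₂ ℤ.* + q₁ ℤ.+ (ℤ.- + p₁) ℤ.* + q₂ ≡ + 1
  isFarey⇒det≡1 p₁ q₁ p₂ q₂ F = begin
    + p₂ ℤ.* + q₁ ℤ.+ (ℤ.- + p₁) ℤ.* + q₂
      ≡⟨ cong₂ ℤ._+_ (ℤ.pos-* p₂ q₁) (ℤ.neg-distribˡ-* (+ p₁) (+ q₂)) ⟨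
    + (p₂ * q₁) ℤ.+ ℤ.- (+ p₁ ℤ.* + q₂)
      ≡⟨ cong (λ z → + (p₂ * q₁) ℤ.+ ℤ.- z) (ℤ.pos-* p₁ q₂) ⟨
    + (p₂ * q₁) ℤ.+ ℤ.- + (p₁ * q₂)   ≡⟨ ℤ.m-n≡m⊖n (p₂ * q₁) (p₁ * q₂) ⟩
    p₂ * q₁ ℤ.⊖ p₁ * q₂               ≡⟨ cong₂ ℤ._⊖_ F (sym (+-identityʳ (p₁ * q₂))) ⟩
    (p₁ * q₂ + 1) ℤ.⊖ (p₁ * q₂ + 0)   ≡⟨ ℤ.+-cancelˡ-⊖ (p₁ * q₂) 1 0 ⟩
    + 1                               ∎
    where open ≡-Reasoning

  toℚᵘ-toℚ : ∀ p s → toℚᵘ (toℚ (p , suc s)) ℚᵘ.≃ mkℚᵘ (+ p) s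
  toℚᵘ-toℚ p s = ℚ.toℚᵘ-fromℚᵘ (mkℚᵘ (+ p) s)

  toℚᵘ-length : ∀ p₁ s₁ p₂ s₂ → IsFarey ⟨ (p₁ , suc s₁) , (p₂ , suc s₂) ⟩ →
    toℚᵘ (length ⟨ (p₁ , suc s₁) , (p₂ , suc s₂) ⟩) ℚᵘ.≃ + 1 ℚᵘ./ (suc s₂ * suc s₁)
  toℚᵘ-length p₁ s₁ p₂ s₂ F = begin
    toℚᵘ (a₂ ℚ.- a₁)                    ≈⟨ ℚ.toℚᵘ-homo-+ a₂ (ℚ.- a₁) ⟩
    toℚᵘ a₂ ℚᵘ.+ toℚᵘ (ℚ.- a₁)          ≈⟨ ℚᵘ.+-cong (toℚᵘ-toℚ p₂ s₂) toℚᵘ-[-a₁] ⟩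
    mkℚᵘ (+ p₂) s₂ ℚᵘ.- mkℚᵘ (+ p₁) s₁  ≡⟨ cong (ℚᵘ._/ (suc s₂ * suc s₁)) det≡1 ⟩
    + 1 ℚᵘ./ (suc s₂ * suc s₁)          ∎
    where
    open ℚᵘ.≃-Reasoning
    a₁ = toℚ (p₁ , suc s₁)
    a₂ = toℚ (p₂ , suc s₂)
    toℚᵘ-[-a₁] = ℚᵘ.≃-trans (ℚ.toℚᵘ-homo‿- a₁) (ℚᵘ.-‿cong (toℚᵘ-toℚ p₁ s₁))
    det≡1 = isFarey⇒det≡1 p₁ (suc s₁) p₂ (suc s₂) F

  ≤ᵘ-fraction : ∀ m b n d → m * suc d ≤ n * suc b → mkℚᵘ (+ m) b ℚᵘ.≤ mkℚᵘ (+ n) d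
  ≤ᵘ-fraction m b n d h = *≤* (subst₂ ℤ._≤_ (ℤ.pos-* m (suc d)) (ℤ.pos-* n (suc b)) (ℤ.+≤+ h))

  module _ (p₁ s₁ p₂ s₂ : ℕ) (F : IsFarey ⟨ (p₁ , suc s₁) , (p₂ , suc s₂) ⟩) where
    private
      I = ⟨ (p₁ , suc s₁) , (p₂ , suc s₂) ⟩
      q₁ = suc s₁
      q₂ = suc s₂
      Q = q₁ + q₂

      length-L : toℚᵘ (length (L I)) ℚᵘ.≃ + 1 ℚᵘ./ (Q * q₁)
      length-L = toℚᵘ-length p₁ s₁ (p₁ + p₂) (s₁ + q₂) (isFarey-L I F)

      length-R : toℚᵘ (length (R I)) ℚᵘ.≃ + 1 ℚᵘ./ (q₂ * Q)
      length-R = toℚᵘ-length (p₁ + p₂) (s₁ + q₂) p₂ s₂ (isFarey-R I F)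

    length-L≤ : ∀ k → q₂ ≤ suc k * q₁ → length (L I) ℚ.≤ (+ suc k ℚ./ 1) ℚ.* length (R I)
    length-L≤ k q₂≤[1+k]q₁ = ℚ.toℚᵘ-cancel-≤
      (ℚᵘ.≤-respˡ-≃ (ℚᵘ.≃-sym length-L)
        (ℚᵘ.≤-respʳ-≃ (ℚᵘ.≃-sym rhs) (≤ᵘ-fraction _ _ _ _ bound)))
      where
      rhs : toℚᵘ ((+ suc k ℚ./ 1) ℚ.* length (R I))
            ℚᵘ.≃ mkℚᵘ (+ suc k) 0 ℚᵘ.* (+ 1 ℚᵘ./ (q₂ * Q))
      rhs = ℚᵘ.≃-trans (ℚ.toℚᵘ-homo-* (+ suc k ℚ./ 1) (length (R I)))
                       (ℚᵘ.*-cong (toℚᵘ-toℚ (suc k) 0) length-R)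
      open ≤-Reasoning
      bound : 1 * (1 * (q₂ * Q)) ≤ suc k * 1 * (Q * q₁)
      bound = begin
        1 * (1 * (q₂ * Q))    ≡⟨ trans (*-identityˡ _) (*-identityˡ _) ⟩
        q₂ * Q                ≤⟨ *-monoˡ-≤ Q q₂≤[1+k]q₁ ⟩
        suc k * q₁ * Q        ≡⟨ *-assoc (suc k) q₁ Q ⟩
        suc k * (q₁ * Q)      ≡⟨ cong₂ _*_ (*-identityʳ (suc k)) (*-comm Q q₁) ⟨
        suc k * 1 * (Q * q₁)  ∎

    length-L≥ : ∀ k → q₁ ≤ suc k * q₂ → (+ 1 ℚ./ suc k) ℚ.* length (R I) ℚ.≤ length (L I)
    length-L≥ k q₁≤[1+k]q₂ = ℚ.toℚᵘ-cancel-≤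
      (ℚᵘ.≤-respʳ-≃ (ℚᵘ.≃-sym length-L)
        (ℚᵘ.≤-respˡ-≃ (ℚᵘ.≃-sym lhs) (≤ᵘ-fraction _ _ _ _ bound)))
      where
      lhs : toℚᵘ ((+ 1 ℚ./ suc k) ℚ.* length (R I))
            ℚᵘ.≃ mkℚᵘ (+ 1) k ℚᵘ.* (+ 1 ℚᵘ./ (q₂ * Q))
      lhs = ℚᵘ.≃-trans (ℚ.toℚᵘ-homo-* (+ 1 ℚ./ suc k) (length (R I)))
                       (ℚᵘ.*-cong (toℚᵘ-toℚ 1 k) length-R)
      open ≤-Reasoning
      bound : 1 * (Q * q₁) ≤ 1 * (suc k * (q₂ * Q))
      bound = begin
        1 * (Q * q₁)              ≡⟨ trans (*-identityˡ _) (*-comm Q q₁) ⟩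
        q₁ * Q                    ≤⟨ *-monoˡ-≤ Q q₁≤[1+k]q₂ ⟩
        suc k * q₂ * Q            ≡⟨ *-assoc (suc k) q₂ Q ⟩
        suc k * (q₂ * Q)          ≡⟨ *-identityˡ _ ⟨
        1 * (suc k * (q₂ * Q))    ∎

open Tameness using (balanced; isFarey⇒0<q₁; module Tame; tame)
open Lengths using (length-L≤; length-L≥)
open import Data.Nat using (zero; suc; z<s)
open import Data.Product using (_×_; _,_; ∃-syntax)
open import Data.Rational using (_≤_; _*_; _/_)
open import Data.Integer using (+_)

corollary6 : (I : Interval) → IsFarey I → IsFinite I →
    ∃[ x ] (IsAloof 4 x × x ∈ᴵ I) →
    ((+ 1) / 5) * length (R I) ≤ length (L I) × length (L I) ≤ ((+ 5) / 1) * length (R I)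
corollary6 ⟨ _ , (_ , zero) ⟩ _ () _
corollary6 I@(⟨ (_ , zero) , (_ , suc _) ⟩) F _ _ with isFarey⇒0<q₁ I F
... | ()
corollary6 I@(⟨ (p₁ , suc s₁) , (p₂ , suc s₂) ⟩) F _ (x , aloof , x∈I)
  with balanced q₁≤5q₂ q₂≤5q₁ ← Tame.denominators (tame x I aloof F x∈I) z<s
  = length-L≥ p₁ s₁ p₂ s₂ F 4 q₁≤5q₂ , length-L≤ p₁ s₁ p₂ s₂ F 4 q₂≤5q₁
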